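{- Fix integers $n\ge 1$ and $0\le m\le N$, where $N=\binom{n}{2}$. For every integer $i\ge 0$, the following identity of square matrices indexed by $U_m$ holds: \[ \Delta_{i+1} = \frac{1}{(i+1)^2}\left\{ i(2m-N-i-1)\Delta_0 + \Delta_1\right\}\Delta_i . \]
   Context: All graphs are simple, undirected, with $n$ vertices. $U_m$ denotes the set of all unlabelled $n$-vertex graphs with exactly $m$ edges. For an integer $j\ge 0$, $\Delta_j$ is the square matrix with rows and columns indexed by $U_m$ whose $(k,l)$-entry is the number of ways to obtain a graph isomorphic to $G_k\in U_m$ from $G_l\in U_m$ by removing a set $A$ of $j$ edges of $G_l$ and then adding a set of $j$ edges not present in $G_l-A$ (the added edges need not be different from the removed ones); that is, it counts pairs (removed $j$-set, added $j$-set) yielding a graph isomorphic to $G_k$. In particular $\Delta_0$ is the identity matrix, and $\Delta_j=0$ when $j>m$. -}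

module Defs where

open import Data.Bool using (Bool; true; false)
open import Data.Nat as ℕ using (ℕ; zero; suc)
open import Data.Fin as Fin using (Fin; toℕ)
open import Data.Fin.Subset using (Subset; _∈_; _⊆_; ∁; _∪_; _─_; ∣_∣)
open import Data.Fin.Subset.Properties using (_⊆?_)
open import Data.Fin.Permutation using (Permutation′; _⟨$⟩ʳ_)
open import Data.Integer as ℤ using (ℤ)
open import Data.List as List using (List; []; _∷_; _++_; length; allFin; concatMap; filter; cartesianProduct)
open import Data.List.Relation.Unary.Any using (Any)
open import Data.Vec as Vec using (Vec)
open import Data.Product using (Σ; _×_; _,_; proj₁; proj₂)
open import Data.Sum using (_⊎_)
open import Relation.Nullary using (Dec)
open import Relation.Nullary.Decidable using (_×-dec_)
open import Relation.Binary.PropositionalEquality using (_≡_)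

-- The list of all unordered pairs {i,j} of vertices of Fin n, encoded as (i , j) with i < j.
-- Its length is N = n C 2.
pairs : (n : ℕ) → List (Fin n × Fin n)
pairs n = concatMap (λ j → List.map (λ i → (i , j)) (filter (λ i → toℕ i ℕ.<? toℕ j) (allFin n))) (allFin n)

L : ℕ → ℕ
L n = length (pairs n)

record Graph (n : ℕ) : Set where
  constructor mkGraph
  field
    edges : Subset (L n)
open Graph public

size : {n : ℕ} → Graph n → ℕ
size G = ∣ edges G ∣

edgeAt : {n : ℕ} → Fin (L n) → Fin n × Fin n
edgeAt {n} p = List.lookup (pairs n) p

Adj : {n : ℕ} → Graph n → Fin n → Fin n → Set
Adj {n} G i j = Σ (Fin (L n)) λ p → (p ∈ edges G) × ((edgeAt p ≡ (i , j)) ⊎ (edgeAt p ≡ (j , i)))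

_≅_ : {n : ℕ} → Graph n → Graph n → Set
_≅_ {n} G H = Σ (Permutation′ n) λ σ → ∀ i j →
  (Adj G i j → Adj H (σ ⟨$⟩ʳ i) (σ ⟨$⟩ʳ j)) × (Adj H (σ ⟨$⟩ʳ i) (σ ⟨$⟩ʳ j) → Adj G i j)

-- a decision procedure for isomorphism (any one; counts do not depend on the choice)
IsoDec : ℕ → Set
IsoDec n = (G H : Graph n) → Dec (G ≅ H)

allSubsets : (k : ℕ) → List (Subset k)
allSubsets zero = Vec.[] ∷ []
allSubsets (suc k) = List.map (true Vec.∷_) (allSubsets k) ++ List.map (false Vec.∷_) (allSubsets k)

Switch : {n : ℕ} → ℕ → Graph n → Graph n → Subset (L n) × Subset (L n) → Set
Switch j G H (A , B) = (A ⊆ edges H) × (∣ A ∣ ≡ j) × (B ⊆ ∁ (edges H ─ A)) × (∣ B ∣ ≡ j) × (mkGraph ((edges H ─ A) ∪ B) ≅ G)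

switch? : {n : ℕ} → IsoDec n → (j : ℕ) → (G H : Graph n) → (x : Subset (L n) × Subset (L n)) → Dec (Switch j G H x)
switch? iso? j G H (A , B) =
  (A ⊆? edges H) ×-dec ((∣ A ∣ ℕ.≟ j) ×-dec ((B ⊆? ∁ (edges H ─ A)) ×-dec ((∣ B ∣ ℕ.≟ j) ×-dec iso? (mkGraph ((edges H ─ A) ∪ B)) G)))

Δcount : {n : ℕ} → IsoDec n → ℕ → Graph n → Graph n → ℕ
Δcount {n} iso? j G H =
  length (filter (switch? iso? j G H) (cartesianProduct (allSubsets (L n)) (allSubsets (L n))))

-- A list of representatives of U_m: one graph from each isomorphism class of n-vertex graphs with m edges.
record IsReps (n m : ℕ) (reps : List (Graph n)) : Set where
  field
    edges    : ∀ (k : Fin (length reps)) → size (List.lookup reps k) ≡ m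
    covers   : ∀ (G : Graph n) → size G ≡ m → Any (λ R → G ≅ R) reps
    distinct : ∀ (k l : Fin (length reps)) → List.lookup reps k ≅ List.lookup reps l → k ≡ l

Δ : {n : ℕ} → IsoDec n → (reps : List (Graph n)) → ℕ → Fin (length reps) → Fin (length reps) → ℤ
Δ iso? reps j k l = ℤ.+ (Δcount iso? j (List.lookup reps k) (List.lookup reps l))

Σℤ : (r : ℕ) → (Fin r → ℤ) → ℤ
Σℤ r f = List.foldr ℤ._+_ (ℤ.+ 0) (List.map f (allFin r))

_·_ : {r : ℕ} → (Fin r → Fin r → ℤ) → (Fin r → Fin r → ℤ) → Fin r → Fin r → ℤ
_·_ {r} M M′ k l = Σℤ r λ p → M k p ℤ.* M′ p l

-- Encode a graph by its edge set among the N = n C 2 vertex pairs, and let up F Y = Σ_{e ∉ Y} F (Y + e)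
-- and down F Y = Σ_{e ∈ Y} F (Y - e) act on integer functions F of edge sets.  The commutator
-- up ∘ down - down ∘ up is multiplication by N - 2|Y|, and down^j (up^j F) H = (j!)² Σ F ((H - A) ∪ B)
-- summed over the j-switches (A , B) of H.  Pushing the inner down of down^i (up^i (down (up F)))
-- leftwards through the ups, one commutator at a time, gives the recurrence
--   switches i (down (up F)) = (i+1)² switches (i+1) F + i (N - 2|H| + i + 1) switches i F.
-- For F the indicator of the isomorphism class of G_k, switches j F (G_l) is Δ_j(k,l); and as
-- down (up F) is invariant under relabelling vertices, Σ_p Δ_1(k,p) Δ_i(p,l) = switches i (down (up F)) (G_l).

module Submission where

open import Defs
open import Data.Bool using (Bool; true; false; not; _∧_; T)
import Data.Bool.Properties as Boolₚ
open import Data.Nat as ℕ using (ℕ; zero; suc; _!; _≤_; _*_)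
import Data.Nat.Properties as ℕₚ
open import Data.Nat.Combinatorics using (_C_; nCk+nC[k+1]≡[n+1]C[k+1]; nC1≡n)
open import Data.Fin as Fin using (Fin; zero; suc; toℕ)
import Data.Fin.Properties as Finₚ
open import Data.Fin.Permutation as Perm using (Permutation′; _⟨$⟩ʳ_; _⟨$⟩ˡ_; inverseˡ; inverseʳ)
open import Data.Fin.Subset using (Subset; ∣_∣; _─_; _∪_; ∁; ⊥)
open import Data.Fin.Subset.Properties using (_⊆?_; ⊆-min; p─⊥≡p)
open import Data.Vec using ([]; _∷_; lookup; _[_]≔_)
import Data.Vec.Properties as Vecₚ
open import Data.List as List using (List; []; _∷_; _++_; length; allFin; filter; cartesianProduct; tabulate; concatMap)
import Data.List.Properties as Listₚ
open import Data.List.Membership.Propositional using (_∈_; lose)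
open import Data.List.Membership.Propositional.Properties using (∈-map⁺; ∈-map⁻; ∈-concatMap⁺; ∈-concatMap⁻; ∈-filter⁺; ∈-filter⁻; ∈-lookup; ∈-allFin)
open import Data.List.Relation.Unary.Any as Any using (Any)
open import Data.List.Relation.Unary.Any.Properties using (lookup-index)
import Data.List.Relation.Unary.All as All
import Data.List.Relation.Unary.All.Properties as Allₚ
import Data.List.Relation.Unary.AllPairs as AllPairs
import Data.List.Relation.Unary.AllPairs.Properties as AllPairsₚ
open import Data.List.Relation.Unary.Unique.Propositional using (Unique)
import Data.List.Relation.Unary.Unique.Propositional.Properties as Uniqueₚ
open import Data.Product using (_×_; _,_; proj₁; proj₂)
open import Data.Sum using (_⊎_; inj₁; inj₂)
open import Data.Integer as ℤ using (ℤ; +_; 0ℤ; 1ℤ; _+_; _-_)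
import Data.Integer.Properties as ℤₚ
import Algebra.Properties.CommutativeMonoid.Sum ℤₚ.+-0-commutativeMonoid as +-Sum
import Algebra.Properties.Semiring.Sum ℤₚ.+-*-semiring as *-Sum
open import Data.Integer.Tactic.RingSolver using (solve-∀)
open import Function using (_∘_)
open import Function.Bundles using (Injection)
open import Function.Properties.Inverse using (↔⇒↣)
open import Relation.Binary.PropositionalEquality
open import Relation.Nullary using (¬_; yes; no; does; contradiction)
open import Relation.Nullary.Decidable using (dec-true; dec-false)
open import Relation.Unary using (Pred; Decidable)

-- Opaque so that unification treats sums rigidly instead of unfolding them to folds.
opaque
  ∑ : ∀ {k} → (Fin k → ℤ) → ℤ
  ∑ = +-Sum.sum

opaque
  unfolding ∑

  ∑-[] : (f : Fin zero → ℤ) → ∑ f ≡ 0ℤ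
  ∑-[] f = refl

  ∑-suc : ∀ {k} (f : Fin (suc k) → ℤ) → ∑ f ≡ f zero + ∑ (f ∘ suc)
  ∑-suc f = refl

  ∑-cong : ∀ {k} {f g : Fin k → ℤ} → f ≗ g → ∑ f ≡ ∑ g
  ∑-cong = +-Sum.sum-cong-≗

  ∑-0 : ∀ k → ∑ {k} (λ _ → 0ℤ) ≡ 0ℤ
  ∑-0 = +-Sum.sum-replicate-zero

  ∑-+ : ∀ {k} (f g : Fin k → ℤ) → ∑ (λ e → f e + g e) ≡ ∑ f + ∑ g
  ∑-+ = +-Sum.∑-distrib-+

  ∑-* : ∀ {k} c (f : Fin k → ℤ) → ∑ (λ e → c ℤ.* f e) ≡ c ℤ.* ∑ f
  ∑-* c f = sym (*-Sum.*-distribˡ-sum c f)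

  ∑-comm : ∀ {k l} (f : Fin k → Fin l → ℤ) → ∑ (λ e → ∑ (f e)) ≡ ∑ (λ d → ∑ (λ e → f e d))
  ∑-comm = +-Sum.∑-comm

  ∑-permute : ∀ {k} (f : Fin k → ℤ) (π : Permutation′ k) → ∑ f ≡ ∑ (λ e → f (π ⟨$⟩ʳ e))
  ∑-permute = +-Sum.sum-permute

when : Bool → ℤ → ℤ
when true  x = x
when false _ = 0ℤ

when-+ : ∀ b x y → when b (x + y) ≡ when b x + when b y
when-+ true  x y = refl
when-+ false x y = refl

when-* : ∀ b c x → when b (c ℤ.* x) ≡ c ℤ.* when b x
when-* true  c x = refl
when-* false c x = sym (ℤₚ.*-zeroʳ c)

when-∧ : ∀ b c x → when b (when c x) ≡ when (b ∧ c) x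
when-∧ true  c x = refl
when-∧ false c x = refl

when-0 : ∀ b → when b 0ℤ ≡ 0ℤ
when-0 true  = refl
when-0 false = refl

when-cong : ∀ b {x y} → (b ≡ true → x ≡ y) → when b x ≡ when b y
when-cong true  x≡y = x≡y refl
when-cong false x≡y = refl

when≡when1* : ∀ b x → when b x ≡ when b 1ℤ ℤ.* x
when≡when1* true  x = sym (ℤₚ.*-identityˡ x)
when≡when1* false x = sym (ℤₚ.*-zeroˡ x)

∑-when : ∀ {k} b (f : Fin k → ℤ) → ∑ (λ e → when b (f e)) ≡ when b (∑ f)
∑-when true  f = refl
∑-when {k} false f = ∑-0 k

∑-when-const : ∀ {k} (b : Fin k → Bool) x → ∑ (λ e → when (b e) x) ≡ ∑ (λ e → when (b e) 1ℤ) ℤ.* x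
∑-when-const {k} b x = begin
  ∑ (λ e → when (b e) x)           ≡⟨ ∑-cong (λ e → trans (when≡when1* (b e) x) (ℤₚ.*-comm _ x)) ⟩
  ∑ (λ e → x ℤ.* when (b e) 1ℤ)    ≡⟨ ∑-* {k} x _ ⟩
  x ℤ.* ∑ (λ e → when (b e) 1ℤ)    ≡⟨ ℤₚ.*-comm x _ ⟩
  ∑ (λ e → when (b e) 1ℤ) ℤ.* x    ∎
  where open ≡-Reasoning

∑-δ : ∀ {k} (e : Fin k) (f : Fin k → ℤ) → ∑ (λ d → when (does (d Fin.≟ e)) (f d)) ≡ f e
∑-δ {suc k} zero    f = trans (∑-suc _) (trans (cong (_+_ (f zero)) (∑-0 k)) (ℤₚ.+-identityʳ (f zero)))
∑-δ {suc k} (suc e) f = trans (∑-suc _) (trans (ℤₚ.+-identityˡ _) (∑-δ e (f ∘ suc)))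

∑-∣∣ : ∀ {k} (Y : Subset k) → ∑ (λ e → when (lookup Y e) 1ℤ) ≡ + ∣ Y ∣
∑-∣∣ []          = ∑-[] _
∑-∣∣ (true  ∷ Y) = trans (∑-suc _) (cong (_+_ 1ℤ) (∑-∣∣ Y))
∑-∣∣ (false ∷ Y) = trans (∑-suc _) (trans (ℤₚ.+-identityˡ _) (∑-∣∣ Y))

∑-∈ : ∀ {k} (Y : Subset k) x → ∑ (λ e → when (lookup Y e) x) ≡ + ∣ Y ∣ ℤ.* x
∑-∈ Y x = trans (∑-when-const (lookup Y) x) (cong (ℤ._* x) (∑-∣∣ Y))

∑-∣∁∣ : ∀ {k} (Y : Subset k) → ∑ (λ e → when (not (lookup Y e)) 1ℤ) ≡ + k - + ∣ Y ∣
∑-∣∁∣ []                  = ∑-[] _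
∑-∣∁∣ {suc k} (true  ∷ Y) = trans (∑-suc _) (trans (ℤₚ.+-identityˡ _) (trans (∑-∣∁∣ Y) (shift (+ k) (+ ∣ Y ∣))))
  where
  shift : ∀ a b → a - b ≡ (1ℤ + a) - (1ℤ + b)
  shift = solve-∀
∑-∣∁∣ {suc k} (false ∷ Y) = trans (∑-suc _) (trans (cong (_+_ 1ℤ) (∑-∣∁∣ Y)) (sym (ℤₚ.+-assoc 1ℤ (+ k) (ℤ.- + ∣ Y ∣))))

∑ˢ : ∀ k → (Subset k → ℤ) → ℤ
∑ˢ zero    f = f []
∑ˢ (suc k) f = ∑ˢ k (f ∘ (true ∷_)) + ∑ˢ k (f ∘ (false ∷_))

∑ˢ-cong : ∀ k {f g : Subset k → ℤ} → (∀ S → f S ≡ g S) → ∑ˢ k f ≡ ∑ˢ k g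
∑ˢ-cong zero    f≗g = f≗g []
∑ˢ-cong (suc k) f≗g = cong₂ _+_ (∑ˢ-cong k (f≗g ∘ (true ∷_))) (∑ˢ-cong k (f≗g ∘ (false ∷_)))

∑ˢ-0 : ∀ k → ∑ˢ k (λ _ → 0ℤ) ≡ 0ℤ
∑ˢ-0 zero    = refl
∑ˢ-0 (suc k) = cong₂ _+_ (∑ˢ-0 k) (∑ˢ-0 k)

∑ˢ-* : ∀ k c (f : Subset k → ℤ) → ∑ˢ k (λ S → c ℤ.* f S) ≡ c ℤ.* ∑ˢ k f
∑ˢ-* zero    c f = refl
∑ˢ-* (suc k) c f = trans (cong₂ _+_ (∑ˢ-* k c (f ∘ (true ∷_))) (∑ˢ-* k c (f ∘ (false ∷_))))
                         (sym (ℤₚ.*-distribˡ-+ c (∑ˢ k (f ∘ (true ∷_))) (∑ˢ k (f ∘ (false ∷_)))))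

∑ˢ-when : ∀ k b (f : Subset k → ℤ) → ∑ˢ k (λ S → when b (f S)) ≡ when b (∑ˢ k f)
∑ˢ-when k true  f = refl
∑ˢ-when k false f = ∑ˢ-0 k

∑ˢ-∑ : ∀ k {l} (f : Subset k → Fin l → ℤ) → ∑ˢ k (λ S → ∑ (f S)) ≡ ∑ (λ e → ∑ˢ k (λ S → f S e))
∑ˢ-∑ zero    f = refl
∑ˢ-∑ (suc k) f = trans (cong₂ _+_ (∑ˢ-∑ k (f ∘ (true ∷_))) (∑ˢ-∑ k (f ∘ (false ∷_))))
                         (sym (∑-+ (λ e → ∑ˢ k (λ S → f (true ∷ S) e)) (λ e → ∑ˢ k (λ S → f (false ∷ S) e))))

∑ˢ-flip : ∀ k (e : Fin k) (G : Subset k → ℤ) →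
  ∑ˢ k (λ A → when (lookup A e) (G A)) ≡ ∑ˢ k (λ A → when (not (lookup A e)) (G (A [ e ]≔ true)))
∑ˢ-flip (suc k) zero    G = ℤₚ.+-comm (∑ˢ k (G ∘ (true ∷_))) (∑ˢ k (λ _ → 0ℤ))
∑ˢ-flip (suc k) (suc e) G = cong₂ _+_ (∑ˢ-flip k e (G ∘ (true ∷_))) (∑ˢ-flip k e (G ∘ (false ∷_)))

∑ˢ-∣∣≡0 : ∀ k (G : Subset k → ℤ) → ∑ˢ k (λ A → when (∣ A ∣ ℕ.≡ᵇ 0) (G A)) ≡ G ⊥
∑ˢ-∣∣≡0 zero    G = refl
∑ˢ-∣∣≡0 (suc k) G = trans (cong (_+ rest) (∑ˢ-0 k)) (trans (ℤₚ.+-identityˡ rest) (∑ˢ-∣∣≡0 k (G ∘ (false ∷_))))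
  where
  rest = ∑ˢ k (λ A → when (∣ A ∣ ℕ.≡ᵇ 0) (G (false ∷ A)))

Fun : ℕ → Set
Fun k = Subset k → ℤ

up : ∀ {k} → Fun k → Fun k
up F Y = ∑ (λ e → when (not (lookup Y e)) (F (Y [ e ]≔ true)))

down : ∀ {k} → Fun k → Fun k
down F Y = ∑ (λ e → when (lookup Y e) (F (Y [ e ]≔ false)))

up-cong : ∀ {k} {F G : Fun k} → F ≗ G → up F ≗ up G
up-cong F≗G Y = ∑-cong (λ e → cong (when (not (lookup Y e))) (F≗G _))

down-cong : ∀ {k} {F G : Fun k} → F ≗ G → down F ≗ down G
down-cong F≗G Y = ∑-cong (λ e → cong (when (lookup Y e)) (F≗G _))

[]≔-unchanged : ∀ {k} (Y : Subset k) e {b} → lookup Y e ≡ b → Y [ e ]≔ b ≡ Y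
[]≔-unchanged Y e refl = Vecₚ.[]≔-lookup Y e

∣[]≔true∣ : ∀ {k} (Y : Subset k) e → lookup Y e ≡ false → ∣ Y [ e ]≔ true ∣ ≡ suc ∣ Y ∣
∣[]≔true∣ (false ∷ Y) zero    _ = refl
∣[]≔true∣ (true  ∷ Y) (suc e) p = cong suc (∣[]≔true∣ Y e p)
∣[]≔true∣ (false ∷ Y) (suc e) p = ∣[]≔true∣ Y e p

∣[]≔false∣ : ∀ {k} (Y : Subset k) e → lookup Y e ≡ true → suc ∣ Y [ e ]≔ false ∣ ≡ ∣ Y ∣
∣[]≔false∣ (true  ∷ Y) zero    _ = refl
∣[]≔false∣ (true  ∷ Y) (suc e) p = cong suc (∣[]≔false∣ Y e p)
∣[]≔false∣ (false ∷ Y) (suc e) p = ∣[]≔false∣ Y e p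

down-add : ∀ {k} (F : Fun k) Y e → lookup Y e ≡ false →
  down F (Y [ e ]≔ true) ≡ F Y + ∑ (λ f → when (lookup Y f) (F ((Y [ e ]≔ true) [ f ]≔ false)))
down-add F Y e Ye≡false = begin
  ∑ (λ f → when (lookup Y⁺ f) (F (Y⁺ [ f ]≔ false)))   ≡⟨ ∑-cong split ⟩
  ∑ (λ f → when (does (f Fin.≟ e)) (F Y) + rest f)     ≡⟨ ∑-+ _ rest ⟩
  ∑ (λ f → when (does (f Fin.≟ e)) (F Y)) + ∑ rest     ≡⟨ cong (_+ ∑ rest) (∑-δ e (λ _ → F Y)) ⟩
  F Y + ∑ rest                                         ∎
  where
  open ≡-Reasoning
  Y⁺ = Y [ e ]≔ true
  rest = λ f → when (lookup Y f) (F (Y⁺ [ f ]≔ false))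
  split : ∀ f → when (lookup Y⁺ f) (F (Y⁺ [ f ]≔ false)) ≡ when (does (f Fin.≟ e)) (F Y) + rest f
  split f with f Fin.≟ e
  ... | yes refl rewrite Vecₚ.lookup∘update f Y true | Vecₚ.[]≔-idempotent {x = true} {false} Y f
                       | []≔-unchanged Y f Ye≡false | Ye≡false = sym (ℤₚ.+-identityʳ (F Y))
  ... | no f≢e = trans (cong (λ b → when b (F (Y⁺ [ f ]≔ false))) (Vecₚ.lookup∘update′ f≢e Y true))
                       (sym (ℤₚ.+-identityˡ (rest f)))

up-remove : ∀ {k} (F : Fun k) Y e → lookup Y e ≡ true →
  up F (Y [ e ]≔ false) ≡ F Y + ∑ (λ f → when (not (lookup Y f)) (F ((Y [ e ]≔ false) [ f ]≔ true)))
up-remove F Y e Ye≡true = begin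
  ∑ (λ f → when (not (lookup Y⁻ f)) (F (Y⁻ [ f ]≔ true)))   ≡⟨ ∑-cong split ⟩
  ∑ (λ f → when (does (f Fin.≟ e)) (F Y) + rest f)          ≡⟨ ∑-+ _ rest ⟩
  ∑ (λ f → when (does (f Fin.≟ e)) (F Y)) + ∑ rest          ≡⟨ cong (_+ ∑ rest) (∑-δ e (λ _ → F Y)) ⟩
  F Y + ∑ rest                                              ∎
  where
  open ≡-Reasoning
  Y⁻ = Y [ e ]≔ false
  rest = λ f → when (not (lookup Y f)) (F (Y⁻ [ f ]≔ true))
  split : ∀ f → when (not (lookup Y⁻ f)) (F (Y⁻ [ f ]≔ true)) ≡ when (does (f Fin.≟ e)) (F Y) + rest f
  split f with f Fin.≟ e
  ... | yes refl rewrite Vecₚ.lookup∘update f Y false | Vecₚ.[]≔-idempotent {x = false} {true} Y f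
                       | []≔-unchanged Y f Ye≡true | Ye≡true = sym (ℤₚ.+-identityʳ (F Y))
  ... | no f≢e = trans (cong (λ b → when (not b) (F (Y⁻ [ f ]≔ true))) (Vecₚ.lookup∘update′ f≢e Y false))
                       (sym (ℤₚ.+-identityˡ (rest f)))

add-remove-swap : ∀ {k} (F : Fun k) Y e f →
  when (not (lookup Y e)) (when (lookup Y f) (F ((Y [ e ]≔ true) [ f ]≔ false)))
    ≡ when (lookup Y f) (when (not (lookup Y e)) (F ((Y [ f ]≔ false) [ e ]≔ true)))
add-remove-swap F Y e f with lookup Y e in Ye | lookup Y f in Yf
... | true  | b     = sym (when-0 b)
... | false | false = refl
... | false | true  = cong F (Vecₚ.[]≔-commutes Y e f e≢f)
  where
  e≢f : e ≢ f
  e≢f refl with () ← trans (sym Ye) Yf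

private
  when-expand : ∀ {k} b {x} y (g : Fin k → ℤ) → (b ≡ true → x ≡ y + ∑ g) →
    when b x ≡ when b y + ∑ (λ f → when b (g f))
  when-expand b y g x≡ = trans (when-cong b x≡) (trans (when-+ b y (∑ g)) (cong (_+_ (when b y)) (sym (∑-when b g))))

module _ {k} (F : Fun k) (Y : Subset k) where

  crossings : ℤ
  crossings = ∑ (λ e → ∑ (λ f → when (not (lookup Y e)) (when (lookup Y f) (F ((Y [ e ]≔ true) [ f ]≔ false)))))

  up-down-expand : up (down F) Y ≡ (+ k - + ∣ Y ∣) ℤ.* F Y + crossings
  up-down-expand = begin
    up (down F) Y
      ≡⟨ ∑-cong (λ e → when-expand (not (lookup Y e)) (F Y) _ (down-add F Y e ∘ Boolₚ.not-injective {y = false})) ⟩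
    ∑ (λ e → when (not (lookup Y e)) (F Y) + _)
      ≡⟨ ∑-+ _ _ ⟩
    ∑ (λ e → when (not (lookup Y e)) (F Y)) + crossings
      ≡⟨ cong (_+ crossings) (trans (∑-when-const _ (F Y)) (cong (ℤ._* F Y) (∑-∣∁∣ Y))) ⟩
    (+ k - + ∣ Y ∣) ℤ.* F Y + crossings ∎
    where open ≡-Reasoning

  down-up-expand : down (up F) Y ≡ + ∣ Y ∣ ℤ.* F Y + crossings
  down-up-expand = begin
    down (up F) Y
      ≡⟨ ∑-cong (λ e → when-expand (lookup Y e) (F Y) _ (up-remove F Y e)) ⟩
    ∑ (λ e → when (lookup Y e) (F Y) + _)
      ≡⟨ ∑-+ _ _ ⟩
    ∑ (λ e → when (lookup Y e) (F Y)) + ∑ (λ e → ∑ (λ f → when (lookup Y e) (when (not (lookup Y f)) (F ((Y [ e ]≔ false) [ f ]≔ true)))))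
      ≡⟨ cong₂ _+_ (trans (∑-when-const _ (F Y)) (cong (ℤ._* F Y) (∑-∣∣ Y)))
                   (trans (∑-comm _) (∑-cong (λ e → ∑-cong (λ f → sym (add-remove-swap F Y e f))))) ⟩
    + ∣ Y ∣ ℤ.* F Y + crossings ∎
    where open ≡-Reasoning

up-down-comm : ∀ {k} (F : Fun k) Y → up (down F) Y ≡ down (up F) Y + (+ k - + ∣ Y ∣ - + ∣ Y ∣) ℤ.* F Y
up-down-comm {k} F Y = begin
  up (down F) Y                                         ≡⟨ up-down-expand F Y ⟩
  (n - c) ℤ.* F Y + crossings F Y                       ≡⟨ regroup n c (F Y) (crossings F Y) ⟩
  (c ℤ.* F Y + crossings F Y) + (n - c - c) ℤ.* F Y     ≡⟨ cong (_+ (n - c - c) ℤ.* F Y) (down-up-expand F Y) ⟨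
  down (up F) Y + (n - c - c) ℤ.* F Y                   ∎
  where
  open ≡-Reasoning
  n = + k
  c = + ∣ Y ∣
  regroup : ∀ n c x X → (n - c) ℤ.* x + X ≡ (c ℤ.* x + X) + (n - c - c) ℤ.* x
  regroup = solve-∀

up^ : ∀ {k} → ℕ → Fun k → Fun k
up^ zero    F = F
up^ (suc i) F = up (up^ i F)

down^ : ∀ {k} → ℕ → Fun k → Fun k
down^ zero    F = F
down^ (suc i) F = down (down^ i F)

down^-cong : ∀ {k} i {F G : Fun k} → F ≗ G → down^ i F ≗ down^ i G
down^-cong zero    F≗G = F≗G
down^-cong (suc i) F≗G = down-cong (down^-cong i F≗G)

up^-up : ∀ {k} i (F : Fun k) → up^ i (up F) ≗ up^ (suc i) F
up^-up zero    F Y = refl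
up^-up (suc i) F   = up-cong (up^-up i F)

down^-down : ∀ {k} i (F : Fun k) → down^ i (down F) ≗ down^ (suc i) F
down^-down zero    F Y = refl
down^-down (suc i) F   = down-cong (down^-down i F)

up-+ : ∀ {k} (F G : Fun k) Y → up (λ Z → F Z + G Z) Y ≡ up F Y + up G Y
up-+ F G Y = trans (∑-cong (λ e → when-+ (not (lookup Y e)) _ _)) (∑-+ _ _)

down-+ : ∀ {k} (F G : Fun k) Y → down (λ Z → F Z + G Z) Y ≡ down F Y + down G Y
down-+ F G Y = trans (∑-cong (λ e → when-+ (lookup Y e) _ _)) (∑-+ _ _)

down^-+ : ∀ {k} i (F G : Fun k) Y → down^ i (λ Z → F Z + G Z) Y ≡ down^ i F Y + down^ i G Y
down^-+ zero    F G Y = refl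
down^-+ (suc i) F G Y = trans (down-cong (down^-+ i F G) Y) (down-+ (down^ i F) (down^ i G) Y)

up-scale : ∀ {k} (c : ℤ → ℤ) (G : Fun k) Y →
  up (λ Z → c (+ ∣ Z ∣) ℤ.* G Z) Y ≡ c (+ ∣ Y ∣ + 1ℤ) ℤ.* up G Y
up-scale c G Y = trans (∑-cong scale) (∑-* (c (+ ∣ Y ∣ + 1ℤ)) _)
  where
  scale : ∀ e → when (not (lookup Y e)) (c (+ ∣ Y [ e ]≔ true ∣) ℤ.* G (Y [ e ]≔ true))
              ≡ c (+ ∣ Y ∣ + 1ℤ) ℤ.* when (not (lookup Y e)) (G (Y [ e ]≔ true))
  scale e with lookup Y e in Ye
  ... | true  = sym (ℤₚ.*-zeroʳ (c (+ ∣ Y ∣ + 1ℤ)))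
  ... | false = cong (λ m → c m ℤ.* G (Y [ e ]≔ true))
                     (trans (cong +_ (∣[]≔true∣ Y e Ye)) (ℤₚ.+-comm 1ℤ (+ ∣ Y ∣)))

-- The size is handed to c as an integer: for empty Y both sides vanish, so no truncated subtraction arises.
down-scale : ∀ {k} (c : ℤ → ℤ) (G : Fun k) Y →
  down (λ Z → c (+ ∣ Z ∣) ℤ.* G Z) Y ≡ c (+ ∣ Y ∣ - 1ℤ) ℤ.* down G Y
down-scale c G Y = trans (∑-cong scale) (∑-* (c (+ ∣ Y ∣ - 1ℤ)) _)
  where
  scale : ∀ e → when (lookup Y e) (c (+ ∣ Y [ e ]≔ false ∣) ℤ.* G (Y [ e ]≔ false))
              ≡ c (+ ∣ Y ∣ - 1ℤ) ℤ.* when (lookup Y e) (G (Y [ e ]≔ false))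
  scale e with lookup Y e in Ye
  ... | false = sym (ℤₚ.*-zeroʳ (c (+ ∣ Y ∣ - 1ℤ)))
  ... | true  = cong (λ m → c m ℤ.* G (Y [ e ]≔ false))
                     (trans (back (+ ∣ Y [ e ]≔ false ∣)) (cong (λ m → + m - 1ℤ) (∣[]≔false∣ Y e Ye)))
    where
    back : ∀ x → x ≡ (1ℤ + x) - 1ℤ
    back = solve-∀

down^-scale : ∀ {k} i (c : ℤ → ℤ) (G : Fun k) Y →
  down^ i (λ Z → c (+ ∣ Z ∣) ℤ.* G Z) Y ≡ c (+ ∣ Y ∣ - + i) ℤ.* down^ i G Y
down^-scale zero    c G Y = cong (λ m → c m ℤ.* G Y) (sym (ℤₚ.+-identityʳ (+ ∣ Y ∣)))
down^-scale (suc i) c G Y = begin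
  down (down^ i (λ Z → c (+ ∣ Z ∣) ℤ.* G Z)) Y       ≡⟨ down-cong (down^-scale i c G) Y ⟩
  down (λ Z → c (+ ∣ Z ∣ - + i) ℤ.* down^ i G Z) Y   ≡⟨ down-scale (λ m → c (m - + i)) (down^ i G) Y ⟩
  c (+ ∣ Y ∣ - 1ℤ - + i) ℤ.* down^ (suc i) G Y       ≡⟨ cong (λ m → c m ℤ.* down^ (suc i) G Y) (shift (+ ∣ Y ∣) (+ i)) ⟩
  c (+ ∣ Y ∣ - + suc i) ℤ.* down^ (suc i) G Y        ∎
  where
  open ≡-Reasoning
  shift : ∀ y i → y - 1ℤ - i ≡ y - (1ℤ + i)
  shift = solve-∀

up^-down-comm : ∀ {k} i (F : Fun k) Y →
  up^ (suc i) (down F) Y ≡ down (up^ (suc i) F) Y + (+ suc i ℤ.* (+ k - + ∣ Y ∣ - + ∣ Y ∣ - + i)) ℤ.* up^ i F Y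
up^-down-comm {k} zero F Y = trans (up-down-comm F Y) (cong (_+_ (down (up F) Y)) (unit (+ k - + ∣ Y ∣ - + ∣ Y ∣) (F Y)))
  where
  unit : ∀ a x → a ℤ.* x ≡ (1ℤ ℤ.* (a - 0ℤ)) ℤ.* x
  unit = solve-∀
up^-down-comm {k} (suc i) F Y = begin
  up (up^ (suc i) (down F)) Y
    ≡⟨ up-cong (up^-down-comm i F) Y ⟩
  up (λ Z → down (up^ (suc i) F) Z + κ i (+ ∣ Z ∣) ℤ.* up^ i F Z) Y
    ≡⟨ up-+ (down (up^ (suc i) F)) (λ Z → κ i (+ ∣ Z ∣) ℤ.* up^ i F Z) Y ⟩
  up (down (up^ (suc i) F)) Y + up (λ Z → κ i (+ ∣ Z ∣) ℤ.* up^ i F Z) Y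
    ≡⟨ cong₂ _+_ (up-down-comm (up^ (suc i) F) Y) (up-scale (κ i) (up^ i F) Y) ⟩
  down (up^ (suc (suc i)) F) Y + (n - y - y) ℤ.* up^ (suc i) F Y + κ i (y + 1ℤ) ℤ.* up^ (suc i) F Y
    ≡⟨ collect (down (up^ (suc (suc i)) F) Y) (up^ (suc i) F Y) n y (+ i) ⟩
  down (up^ (suc (suc i)) F) Y + κ (suc i) y ℤ.* up^ (suc i) F Y
    ∎
  where
  open ≡-Reasoning
  κ : ℕ → ℤ → ℤ
  κ i y = + suc i ℤ.* (+ k - y - y - + i)
  n = + k
  y = + ∣ Y ∣
  collect : ∀ a x n y i → a + (n - y - y) ℤ.* x + ((1ℤ + i) ℤ.* (n - (y + 1ℤ) - (y + 1ℤ) - i)) ℤ.* x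
                        ≡ a + ((1ℤ + (1ℤ + i)) ℤ.* (n - y - y - (1ℤ + i))) ℤ.* x
  collect = solve-∀

down^up^-down-up : ∀ {k} i (Q : Fun k) H →
  down^ i (up^ i (down (up Q))) H
    ≡ down^ (suc i) (up^ (suc i) Q) H + (+ i ℤ.* (+ k - + ∣ H ∣ - + ∣ H ∣ + + i + 1ℤ)) ℤ.* down^ i (up^ i Q) H
down^up^-down-up {k} zero Q H = vanish (down (up Q) H) (+ k - + ∣ H ∣ - + ∣ H ∣ + 0ℤ + 1ℤ) (Q H)
  where
  vanish : ∀ a c x → a ≡ a + (0ℤ ℤ.* c) ℤ.* x
  vanish = solve-∀
down^up^-down-up {k} (suc j) Q H = begin
  down^ (suc j) (up^ (suc j) (down (up Q))) H
    ≡⟨ down^-cong (suc j) (up^-down-comm j (up Q)) H ⟩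
  down^ (suc j) (λ Z → down (up^ (suc j) (up Q)) Z + κ (+ ∣ Z ∣) ℤ.* up^ j (up Q) Z) H
    ≡⟨ down^-+ (suc j) (down (up^ (suc j) (up Q))) (λ Z → κ (+ ∣ Z ∣) ℤ.* up^ j (up Q) Z) H ⟩
  down^ (suc j) (down (up^ (suc j) (up Q))) H + down^ (suc j) (λ Z → κ (+ ∣ Z ∣) ℤ.* up^ j (up Q) Z) H
    ≡⟨ cong₂ _+_ (trans (down^-down (suc j) _ H) (down^-cong (suc (suc j)) (up^-up (suc j) Q) H))
                 (down^-scale (suc j) κ (up^ j (up Q)) H) ⟩
  down^ (suc (suc j)) (up^ (suc (suc j)) Q) H + κ (+ ∣ H ∣ - + suc j) ℤ.* down^ (suc j) (up^ j (up Q)) H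
    ≡⟨ cong₂ (λ c x → down^ (suc (suc j)) (up^ (suc (suc j)) Q) H + c ℤ.* x)
             (shift (+ k) (+ ∣ H ∣) (+ j)) (down^-cong (suc j) (up^-up j Q) H) ⟩
  down^ (suc (suc j)) (up^ (suc (suc j)) Q) H
    + (+ suc j ℤ.* (+ k - + ∣ H ∣ - + ∣ H ∣ + + suc j + 1ℤ)) ℤ.* down^ (suc j) (up^ (suc j) Q) H
    ∎
  where
  open ≡-Reasoning
  κ : ℤ → ℤ
  κ y = + suc j ℤ.* (+ k - y - y - + j)
  shift : ∀ n h j → (1ℤ + j) ℤ.* (n - (h - (1ℤ + j)) - (h - (1ℤ + j)) - j) ≡ (1ℤ + j) ℤ.* (n - h - h + (1ℤ + j) + 1ℤ)
  shift = solve-∀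

module _ {k} (π : Permutation′ k) where

  _~_ : Subset k → Subset k → Set
  Z ~ Z′ = ∀ e → lookup Z e ≡ lookup Z′ (π ⟨$⟩ʳ e)

  Invariant : Fun k → Set
  Invariant F = ∀ Z Z′ → Z ~ Z′ → F Z ≡ F Z′

  ~-[]≔ : ∀ Z Z′ e b → Z ~ Z′ → (Z [ e ]≔ b) ~ (Z′ [ π ⟨$⟩ʳ e ]≔ b)
  ~-[]≔ Z Z′ e b Z~Z′ d with d Fin.≟ e
  ... | yes refl = trans (Vecₚ.lookup∘update d Z b) (sym (Vecₚ.lookup∘update (π ⟨$⟩ʳ d) Z′ b))
  ... | no d≢e   = trans (Vecₚ.lookup∘update′ d≢e Z b)
                         (trans (Z~Z′ d) (sym (Vecₚ.lookup∘update′ (d≢e ∘ Injection.injective (↔⇒↣ π)) Z′ b)))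

  up-invariant : ∀ F → Invariant F → Invariant (up F)
  up-invariant F F-inv Z Z′ Z~Z′ = trans
    (∑-cong (λ e → cong₂ (λ b x → when (not b) x) (Z~Z′ e) (F-inv _ _ (~-[]≔ Z Z′ e true Z~Z′))))
    (sym (∑-permute _ π))

  down-invariant : ∀ F → Invariant F → Invariant (down F)
  down-invariant F F-inv Z Z′ Z~Z′ = trans
    (∑-cong (λ e → cong₂ when (Z~Z′ e) (F-inv _ _ (~-[]≔ Z Z′ e false Z~Z′))))
    (sym (∑-permute _ π))

_⊆ᵇ_ : ∀ {k} → Subset k → Subset k → Bool
A ⊆ᵇ H = does (A ⊆? H)

⊆ᵇ-[]≔true : ∀ {k} (A H : Subset k) e → lookup A e ≡ false → (A [ e ]≔ true) ⊆ᵇ H ≡ lookup H e ∧ A ⊆ᵇ H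
⊆ᵇ-[]≔true (false ∷ A) (true  ∷ H) zero    _ = refl
⊆ᵇ-[]≔true (false ∷ A) (false ∷ H) zero    _ = refl
⊆ᵇ-[]≔true (true  ∷ A) (true  ∷ H) (suc e) p = ⊆ᵇ-[]≔true A H e p
⊆ᵇ-[]≔true (true  ∷ A) (false ∷ H) (suc e) p = sym (Boolₚ.∧-zeroʳ (lookup H e))
⊆ᵇ-[]≔true (false ∷ A) (h     ∷ H) (suc e) p = ⊆ᵇ-[]≔true A H e p

⊆ᵇ-[]≔false-∉ : ∀ {k} (A H : Subset k) e → lookup A e ≡ false → A ⊆ᵇ (H [ e ]≔ false) ≡ A ⊆ᵇ H
⊆ᵇ-[]≔false-∉ (false ∷ A) (h     ∷ H) zero    _ = refl
⊆ᵇ-[]≔false-∉ (true  ∷ A) (true  ∷ H) (suc e) p = ⊆ᵇ-[]≔false-∉ A H e p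
⊆ᵇ-[]≔false-∉ (true  ∷ A) (false ∷ H) (suc e) p = refl
⊆ᵇ-[]≔false-∉ (false ∷ A) (h     ∷ H) (suc e) p = ⊆ᵇ-[]≔false-∉ A H e p

⊆ᵇ-[]≔false-∈ : ∀ {k} (A H : Subset k) e → lookup A e ≡ true → A ⊆ᵇ (H [ e ]≔ false) ≡ false
⊆ᵇ-[]≔false-∈ (true  ∷ A) (h     ∷ H) zero    _ = refl
⊆ᵇ-[]≔false-∈ (true  ∷ A) (true  ∷ H) (suc e) p = ⊆ᵇ-[]≔false-∈ A H e p
⊆ᵇ-[]≔false-∈ (true  ∷ A) (false ∷ H) (suc e) p = refl
⊆ᵇ-[]≔false-∈ (false ∷ A) (h     ∷ H) (suc e) p = ⊆ᵇ-[]≔false-∈ A H e p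

[]≔false-─ : ∀ {k} (H A : Subset k) e → (H [ e ]≔ false) ─ A ≡ H ─ (A [ e ]≔ true)
[]≔false-─ (h ∷ H) (true  ∷ A) zero    = refl
[]≔false-─ (h ∷ H) (false ∷ A) zero    = refl
[]≔false-─ (h ∷ H) (true  ∷ A) (suc e) = cong (false ∷_) ([]≔false-─ H A e)
[]≔false-─ (h ∷ H) (false ∷ A) (suc e) = cong (h ∷_) ([]≔false-─ H A e)

when-∧-swap : ∀ a b x → when (a ∧ b) x ≡ when b (when a x)
when-∧-swap a b x = trans (cong (λ c → when c x) (Boolₚ.∧-comm a b)) (sym (when-∧ b a x))

*-when-≡ᵇ : ∀ b n m x → + m ℤ.* when (b ∧ (n ℕ.≡ᵇ m)) x ≡ + n ℤ.* when (b ∧ (n ℕ.≡ᵇ m)) x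
*-when-≡ᵇ false n m x = trans (ℤₚ.*-zeroʳ (+ m)) (sym (ℤₚ.*-zeroʳ (+ n)))
*-when-≡ᵇ true  n m x with n ℕ.≡ᵇ m in n≡ᵇm
... | true  = cong (λ c → + c ℤ.* x) (sym (ℕₚ.≡ᵇ⇒≡ n m (subst T (sym n≡ᵇm) _)))
... | false = trans (ℤₚ.*-zeroʳ (+ m)) (sym (ℤₚ.*-zeroʳ (+ n)))

removals : ∀ {k} → ℕ → Fun k → Fun k
removals {k} j F H = ∑ˢ k (λ A → when (A ⊆ᵇ H ∧ (∣ A ∣ ℕ.≡ᵇ j)) (F (H ─ A)))

removals-zero : ∀ {k} (F : Fun k) H → removals 0 F H ≡ F H
removals-zero {k} F H = begin
  ∑ˢ k (λ A → when (A ⊆ᵇ H ∧ (∣ A ∣ ℕ.≡ᵇ 0)) (F (H ─ A)))      ≡⟨ ∑ˢ-cong k (λ A → when-∧-swap (A ⊆ᵇ H) _ _) ⟩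
  ∑ˢ k (λ A → when (∣ A ∣ ℕ.≡ᵇ 0) (when (A ⊆ᵇ H) (F (H ─ A))))   ≡⟨ ∑ˢ-∣∣≡0 k (λ A → when (A ⊆ᵇ H) (F (H ─ A))) ⟩
  when (⊥ ⊆ᵇ H) (F (H ─ ⊥))                                    ≡⟨ cong₂ when (dec-true (⊥ ⊆? H) (⊆-min H)) (cong F (p─⊥≡p H)) ⟩
  F H                                                          ∎
  where open ≡-Reasoning

removals-suc : ∀ {k} j (F : Fun k) H →
  ∑ (λ e → when (lookup H e) (removals j F (H [ e ]≔ false))) ≡ + suc j ℤ.* removals (suc j) F H
removals-suc {k} j F H = sym (begin
  + suc j ℤ.* ∑ˢ k G                               ≡⟨ ∑ˢ-* k (+ suc j) G ⟨
  ∑ˢ k (λ A → + suc j ℤ.* G A)                     ≡⟨ ∑ˢ-cong k count ⟩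
  ∑ˢ k (λ A → ∑ (λ e → when (lookup A e) (G A)))   ≡⟨ ∑ˢ-∑ k (λ A e → when (lookup A e) (G A)) ⟩
  ∑ (λ e → ∑ˢ k (λ A → when (lookup A e) (G A)))   ≡⟨ ∑-cong (λ e → ∑ˢ-flip k e G) ⟩
  ∑ (λ e → ∑ˢ k (λ A → when (not (lookup A e)) (G (A [ e ]≔ true))))
    ≡⟨ ∑-cong (λ e → trans (∑ˢ-cong k (remove e)) (∑ˢ-when k (lookup H e) _)) ⟩
  ∑ (λ e → when (lookup H e) (removals j F (H [ e ]≔ false))) ∎)
  where
  open ≡-Reasoning
  G : Subset k → ℤ
  G A = when (A ⊆ᵇ H ∧ (∣ A ∣ ℕ.≡ᵇ suc j)) (F (H ─ A))
  count : ∀ A → + suc j ℤ.* G A ≡ ∑ (λ e → when (lookup A e) (G A))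
  count A = trans (*-when-≡ᵇ (A ⊆ᵇ H) ∣ A ∣ (suc j) _) (sym (∑-∈ A (G A)))
  remove : ∀ e A → when (not (lookup A e)) (G (A [ e ]≔ true))
                 ≡ when (lookup H e) (when (A ⊆ᵇ (H [ e ]≔ false) ∧ (∣ A ∣ ℕ.≡ᵇ j)) (F ((H [ e ]≔ false) ─ A)))
  remove e A with lookup A e in Ae
  ... | true  rewrite ⊆ᵇ-[]≔false-∈ A H e Ae = sym (when-0 (lookup H e))
  ... | false rewrite ⊆ᵇ-[]≔true A H e Ae | ⊆ᵇ-[]≔false-∉ A H e Ae | ∣[]≔true∣ A e Ae | []≔false-─ H A e
    = trans (cong (λ c → when c _) (Boolₚ.∧-assoc (lookup H e) (A ⊆ᵇ H) _)) (sym (when-∧ (lookup H e) _ _))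

down^-removals : ∀ {k} j (F : Fun k) H → down^ j F H ≡ + (j !) ℤ.* removals j F H
down^-removals zero    F H = sym (trans (ℤₚ.*-identityˡ _) (removals-zero F H))
down^-removals (suc j) F H = begin
  ∑ (λ e → when (lookup H e) (down^ j F (H [ e ]≔ false)))
    ≡⟨ ∑-cong (λ e → trans (cong (when (lookup H e)) (down^-removals j F _)) (when-* (lookup H e) (+ (j !)) _)) ⟩
  ∑ (λ e → + (j !) ℤ.* when (lookup H e) (removals j F (H [ e ]≔ false)))
    ≡⟨ ∑-* (+ (j !)) _ ⟩
  + (j !) ℤ.* ∑ (λ e → when (lookup H e) (removals j F (H [ e ]≔ false)))
    ≡⟨ cong (ℤ._*_ (+ (j !))) (removals-suc j F H) ⟩
  + (j !) ℤ.* (+ suc j ℤ.* removals (suc j) F H)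
    ≡⟨ ℤₚ.*-assoc (+ (j !)) (+ suc j) _ ⟨
  (+ (j !) ℤ.* + suc j) ℤ.* removals (suc j) F H
    ≡⟨ cong (ℤ._* removals (suc j) F H) (trans (ℤₚ.*-comm (+ (j !)) (+ suc j)) (sym (ℤₚ.pos-* (suc j) (j !)))) ⟩
  + (suc j !) ℤ.* removals (suc j) F H ∎
  where open ≡-Reasoning

additions : ∀ {k} → ℕ → Fun k → Fun k
additions {k} j F Y = ∑ˢ k (λ B → when (B ⊆ᵇ ∁ Y ∧ (∣ B ∣ ℕ.≡ᵇ j)) (F (Y ∪ B)))

∁-involutive : ∀ {k} (Y : Subset k) → ∁ (∁ Y) ≡ Y
∁-involutive []      = refl
∁-involutive (y ∷ Y) = cong₂ _∷_ (Boolₚ.not-involutive y) (∁-involutive Y)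

∁-[]≔ : ∀ {k} (Y : Subset k) e → ∁ (∁ Y [ e ]≔ false) ≡ Y [ e ]≔ true
∁-[]≔ Y e = trans (Vecₚ.map-[]≔ not (∁ Y) e) (cong (_[ e ]≔ true) (∁-involutive Y))

∁-─-∁ : ∀ {k} (Y B : Subset k) → ∁ (∁ Y ─ B) ≡ Y ∪ B
∁-─-∁ []      []          = refl
∁-─-∁ (y ∷ Y) (true  ∷ B) = cong₂ _∷_ (sym (Boolₚ.∨-zeroʳ y)) (∁-─-∁ Y B)
∁-─-∁ (y ∷ Y) (false ∷ B) = cong₂ _∷_ (trans (Boolₚ.not-involutive y) (sym (Boolₚ.∨-identityʳ y))) (∁-─-∁ Y B)

up≡down∘∁ : ∀ {k} (F : Fun k) Y → up F Y ≡ down (F ∘ ∁) (∁ Y)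
up≡down∘∁ F Y = ∑-cong (λ e → cong₂ when (sym (Vecₚ.lookup-map e not Y)) (cong F (sym (∁-[]≔ Y e))))

up^≡down^∘∁ : ∀ {k} j (F : Fun k) Y → up^ j F Y ≡ down^ j (F ∘ ∁) (∁ Y)
up^≡down^∘∁ zero    F Y = cong F (sym (∁-involutive Y))
up^≡down^∘∁ (suc j) F Y = trans (up≡down∘∁ (up^ j F) Y)
  (down-cong (λ Z → trans (up^≡down^∘∁ j F (∁ Z)) (cong (down^ j (F ∘ ∁)) (∁-involutive Z))) (∁ Y))

up^-additions : ∀ {k} j (F : Fun k) Y → up^ j F Y ≡ + (j !) ℤ.* additions j F Y
up^-additions {k} j F Y = trans (up^≡down^∘∁ j F Y) (trans (down^-removals j (F ∘ ∁) (∁ Y))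
  (cong (ℤ._*_ (+ (j !))) (∑ˢ-cong k (λ B → cong (when (B ⊆ᵇ ∁ Y ∧ (∣ B ∣ ℕ.≡ᵇ j))) (cong F (∁-─-∁ Y B))))))

switches : ∀ {k} → ℕ → Fun k → Fun k
switches j F = removals j (additions j F)

removals-cong : ∀ {k} j {F G : Fun k} → F ≗ G → removals j F ≗ removals j G
removals-cong {k} j F≗G H = ∑ˢ-cong k (λ A → cong (when (A ⊆ᵇ H ∧ (∣ A ∣ ℕ.≡ᵇ j))) (F≗G (H ─ A)))

removals-* : ∀ {k} j c (F : Fun k) H → removals j (λ Z → c ℤ.* F Z) H ≡ c ℤ.* removals j F H
removals-* {k} j c F H =
  trans (∑ˢ-cong k (λ A → when-* (A ⊆ᵇ H ∧ (∣ A ∣ ℕ.≡ᵇ j)) c (F (H ─ A)))) (∑ˢ-* k c _)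

removals-∑ : ∀ {k r} j (F : Fin r → Fun k) H → removals j (λ Z → ∑ (λ p → F p Z)) H ≡ ∑ (λ p → removals j (F p) H)
removals-∑ {k} j F H =
  trans (∑ˢ-cong k (λ A → sym (∑-when (A ⊆ᵇ H ∧ (∣ A ∣ ℕ.≡ᵇ j)) (λ p → F p (H ─ A))))) (∑ˢ-∑ k _)

additions-* : ∀ {k} j c (F : Fun k) Y → additions j (λ Z → c ℤ.* F Z) Y ≡ c ℤ.* additions j F Y
additions-* {k} j c F Y =
  trans (∑ˢ-cong k (λ B → when-* (B ⊆ᵇ ∁ Y ∧ (∣ B ∣ ℕ.≡ᵇ j)) c (F (Y ∪ B)))) (∑ˢ-* k c _)

additions-∑ : ∀ {k r} j (F : Fin r → Fun k) Y → additions j (λ Z → ∑ (λ p → F p Z)) Y ≡ ∑ (λ p → additions j (F p) Y)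
additions-∑ {k} j F Y =
  trans (∑ˢ-cong k (λ B → sym (∑-when (B ⊆ᵇ ∁ Y ∧ (∣ B ∣ ℕ.≡ᵇ j)) (λ p → F p (Y ∪ B))))) (∑ˢ-∑ k _)

switches-* : ∀ {k} j c (F : Fun k) H → switches j (λ Z → c ℤ.* F Z) H ≡ c ℤ.* switches j F H
switches-* j c F H = trans (removals-cong j (additions-* j c F) H) (removals-* j c (additions j F) H)

switches-∑ : ∀ {k r} j (F : Fin r → Fun k) H → switches j (λ Z → ∑ (λ p → F p Z)) H ≡ ∑ (λ p → switches j (F p) H)
switches-∑ j F H = trans (removals-cong j (additions-∑ j F) H) (removals-∑ j (λ p → additions j (F p)) H)

down^up^-switches : ∀ {k} j (F : Fun k) H → down^ j (up^ j F) H ≡ (+ (j !) ℤ.* + (j !)) ℤ.* switches j F H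
down^up^-switches j F H = begin
  down^ j (up^ j F) H                              ≡⟨ down^-removals j (up^ j F) H ⟩
  + (j !) ℤ.* removals j (up^ j F) H               ≡⟨ cong (ℤ._*_ (+ (j !))) (removals-cong j (up^-additions j F) H) ⟩
  + (j !) ℤ.* removals j (λ Z → + (j !) ℤ.* additions j F Z) H
                                                   ≡⟨ cong (ℤ._*_ (+ (j !))) (removals-* j (+ (j !)) (additions j F) H) ⟩
  + (j !) ℤ.* (+ (j !) ℤ.* switches j F H)         ≡⟨ ℤₚ.*-assoc (+ (j !)) (+ (j !)) _ ⟨
  (+ (j !) ℤ.* + (j !)) ℤ.* switches j F H         ∎
  where open ≡-Reasoning

switches-zero : ∀ {k} (F : Fun k) H → switches 0 F H ≡ F H
switches-zero F H = sym (trans (down^up^-switches 0 F H) (ℤₚ.*-identityˡ _))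

switches-one : ∀ {k} (F : Fun k) H → switches 1 F H ≡ down (up F) H
switches-one F H = sym (trans (down^up^-switches 1 F H) (ℤₚ.*-identityˡ _))

switches-down-up : ∀ {k} i (Q : Fun k) H →
  switches i (down (up Q)) H
    ≡ (+ suc i ℤ.* + suc i) ℤ.* switches (suc i) Q H + (+ i ℤ.* (+ k - + ∣ H ∣ - + ∣ H ∣ + + i + 1ℤ)) ℤ.* switches i Q H
switches-down-up {k} i Q H = ℤₚ.*-cancelˡ-≡ (+ (i ! ℕ.* i !)) _ _ {{ℕₚ._!*_!≢0 i i}} (begin
  + (i ! ℕ.* i !) ℤ.* switches i (down (up Q)) H
    ≡⟨ cong (ℤ._* switches i (down (up Q)) H) (ℤₚ.pos-* (i !) (i !)) ⟩
  (f ℤ.* f) ℤ.* switches i (down (up Q)) H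
    ≡⟨ down^up^-switches i (down (up Q)) H ⟨
  down^ i (up^ i (down (up Q))) H
    ≡⟨ down^up^-down-up i Q H ⟩
  down^ (suc i) (up^ (suc i) Q) H + c ℤ.* down^ i (up^ i Q) H
    ≡⟨ cong₂ (λ x y → x + c ℤ.* y) (down^up^-switches (suc i) Q H) (down^up^-switches i Q H) ⟩
  (+ (suc i !) ℤ.* + (suc i !)) ℤ.* switches (suc i) Q H + c ℤ.* ((f ℤ.* f) ℤ.* switches i Q H)
    ≡⟨ cong (λ x → (x ℤ.* x) ℤ.* switches (suc i) Q H + c ℤ.* ((f ℤ.* f) ℤ.* switches i Q H)) (ℤₚ.pos-* (suc i) (i !)) ⟩
  ((+ suc i ℤ.* f) ℤ.* (+ suc i ℤ.* f)) ℤ.* switches (suc i) Q H + c ℤ.* ((f ℤ.* f) ℤ.* switches i Q H)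
    ≡⟨ factor f (+ suc i) c (switches (suc i) Q H) (switches i Q H) ⟩
  (f ℤ.* f) ℤ.* rhs
    ≡⟨ cong (ℤ._* rhs) (ℤₚ.pos-* (i !) (i !)) ⟨
  + (i ! ℕ.* i !) ℤ.* rhs
    ∎)
  where
  open ≡-Reasoning
  f = + (i !)
  c = + i ℤ.* (+ k - + ∣ H ∣ - + ∣ H ∣ + + i + 1ℤ)
  rhs = (+ suc i ℤ.* + suc i) ℤ.* switches (suc i) Q H + c ℤ.* switches i Q H
  factor : ∀ f s c a b → (s ℤ.* f) ℤ.* (s ℤ.* f) ℤ.* a + c ℤ.* ((f ℤ.* f) ℤ.* b) ≡ (f ℤ.* f) ℤ.* ((s ℤ.* s) ℤ.* a + c ℤ.* b)
  factor = solve-∀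

∣─∣ : ∀ {k} (H A : Subset k) → A ⊆ᵇ H ≡ true → ∣ H ─ A ∣ ℕ.+ ∣ A ∣ ≡ ∣ H ∣
∣─∣ []          []          _ = refl
∣─∣ (true  ∷ H) (true  ∷ A) p = trans (ℕₚ.+-suc _ _) (cong suc (∣─∣ H A p))
∣─∣ (true  ∷ H) (false ∷ A) p = cong suc (∣─∣ H A p)
∣─∣ (false ∷ H) (false ∷ A) p = ∣─∣ H A p

∣∪∣ : ∀ {k} (Y B : Subset k) → B ⊆ᵇ ∁ Y ≡ true → ∣ Y ∪ B ∣ ≡ ∣ Y ∣ ℕ.+ ∣ B ∣
∣∪∣ []          []          _ = refl
∣∪∣ (false ∷ Y) (true  ∷ B) p = trans (cong suc (∣∪∣ Y B p)) (sym (ℕₚ.+-suc _ _))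
∣∪∣ (true  ∷ Y) (false ∷ B) p = cong suc (∣∪∣ Y B p)
∣∪∣ (false ∷ Y) (false ∷ B) p = ∣∪∣ Y B p

switches-cong-level : ∀ {k} j {F G : Fun k} H → (∀ Z → ∣ Z ∣ ≡ ∣ H ∣ → F Z ≡ G Z) → switches j F H ≡ switches j G H
switches-cong-level {k} j {F} {G} H F≐G = ∑ˢ-cong k λ A → when-cong (A ⊆ᵇ H ∧ (∣ A ∣ ℕ.≡ᵇ j)) λ cA →
  ∑ˢ-cong k λ B → when-cong (B ⊆ᵇ ∁ (H ─ A) ∧ (∣ B ∣ ℕ.≡ᵇ j)) λ cB → F≐G ((H ─ A) ∪ B) (begin
    ∣ (H ─ A) ∪ B ∣          ≡⟨ ∣∪∣ (H ─ A) B (Boolₚ.∧-conicalˡ _ _ cB) ⟩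
    ∣ H ─ A ∣ ℕ.+ ∣ B ∣      ≡⟨ cong (∣ H ─ A ∣ ℕ.+_) (trans (card≡ ∣ B ∣ cB) (sym (card≡ ∣ A ∣ cA))) ⟩
    ∣ H ─ A ∣ ℕ.+ ∣ A ∣      ≡⟨ ∣─∣ H A (Boolₚ.∧-conicalˡ _ _ cA) ⟩
    ∣ H ∣                    ∎)
  where
  open ≡-Reasoning
  card≡ : ∀ {a} n → a ∧ (n ℕ.≡ᵇ j) ≡ true → n ≡ j
  card≡ {a} n c = ℕₚ.≡ᵇ⇒≡ n j (subst T (sym (Boolₚ.∧-conicalʳ a _ c)) _)

lookup-injective : ∀ {a} {A : Set a} {xs : List A} → Unique xs →
  ∀ p q → List.lookup xs p ≡ List.lookup xs q → p ≡ q
lookup-injective (_  AllPairs.∷ _) zero    zero    _  = refl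
lookup-injective (x∉ AllPairs.∷ _) zero    (suc q) eq = contradiction eq (All.lookup x∉ (∈-lookup q))
lookup-injective (x∉ AllPairs.∷ _) (suc p) zero    eq = contradiction (sym eq) (All.lookup x∉ (∈-lookup p))
lookup-injective (_  AllPairs.∷ u) (suc p) (suc q) eq = cong suc (lookup-injective u p q eq)

Ordered : ∀ {n} → Fin n × Fin n → Set
Ordered (u , v) = toℕ u ℕ.< toℕ v

module _ (n : ℕ) where

  private
    column : Fin n → List (Fin n × Fin n)
    column j = List.map (λ i → (i , j)) (filter (λ i → toℕ i ℕ.<? toℕ j) (allFin n))

    ∈-column : ∀ {x} j → x ∈ column j → Ordered x × proj₂ x ≡ j
    ∈-column j x∈ with ∈-map⁻ (λ i → (i , j)) x∈
    ... | i , i∈ , refl = proj₂ (∈-filter⁻ (λ i → toℕ i ℕ.<? toℕ j) {xs = allFin n} i∈) , refl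

  pairs-ordered : ∀ {x} → x ∈ pairs n → Ordered x
  pairs-ordered x∈ with Any.satisfied (∈-concatMap⁻ column {xs = allFin n} x∈)
  ... | j , x∈j = proj₁ (∈-column j x∈j)

  ∈-pairs : ∀ u v → Ordered (u , v) → (u , v) ∈ pairs n
  ∈-pairs u v u<v = ∈-concatMap⁺ column
    (lose (∈-allFin v) (∈-map⁺ (λ i → (i , v)) (∈-filter⁺ (λ i → toℕ i ℕ.<? toℕ v) (∈-allFin u) u<v)))

  pairs-unique : Unique (pairs n)
  pairs-unique = Uniqueₚ.concat⁺ (Allₚ.map⁺ (Allₚ.tabulate⁺ column-unique))
                                 (AllPairsₚ.map⁺ (AllPairsₚ.tabulate⁺ columns-disjoint))
    where
    column-unique : ∀ j → Unique (column j)
    column-unique j = Uniqueₚ.map⁺ (cong proj₁) (Uniqueₚ.filter⁺ (λ i → toℕ i ℕ.<? toℕ j) (Uniqueₚ.allFin⁺ n))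
    columns-disjoint : ∀ {i j} → i ≢ j → ∀ {x} → ¬ (x ∈ column i × x ∈ column j)
    columns-disjoint i≢j (x∈i , x∈j) = i≢j (trans (sym (proj₂ (∈-column _ x∈i))) (proj₂ (∈-column _ x∈j)))

edgeAt-injective : ∀ {n} (p q : Fin (L n)) → edgeAt {n} p ≡ edgeAt q → p ≡ q
edgeAt-injective {n} = lookup-injective (pairs-unique n)

edgeAt-ordered : ∀ {n} (p : Fin (L n)) → Ordered (edgeAt {n} p)
edgeAt-ordered {n} p = pairs-ordered n (∈-lookup p)

positionOf : ∀ {n} (u v : Fin n) → Ordered (u , v) → Fin (L n)
positionOf {n} u v u<v = Any.index (∈-pairs n u v u<v)

edgeAt-positionOf : ∀ {n} (u v : Fin n) (u<v : Ordered (u , v)) → edgeAt {n} (positionOf u v u<v) ≡ (u , v)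
edgeAt-positionOf {n} u v u<v = sym (lookup-index (∈-pairs n u v u<v))

Joins : ∀ {n} → Fin n × Fin n → Fin n → Fin n → Set
Joins x a b = x ≡ (a , b) ⊎ x ≡ (b , a)

Joins-swap : ∀ {n} {x : Fin n × Fin n} {a b} → Joins x a b → Joins x b a
Joins-swap (inj₁ x≡ab) = inj₂ x≡ab
Joins-swap (inj₂ x≡ba) = inj₁ x≡ba

sort : ∀ {n} → Fin n → Fin n → Fin n × Fin n
sort a b with toℕ a ℕ.<? toℕ b
... | yes _ = (a , b)
... | no  _ = (b , a)

sort-joins : ∀ {n} (a b : Fin n) → Joins (sort a b) a b
sort-joins a b with toℕ a ℕ.<? toℕ b
... | yes _ = inj₁ refl
... | no  _ = inj₂ refl

sort-ordered : ∀ {n} {a b : Fin n} → a ≢ b → Ordered (sort a b)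
sort-ordered {a = a} {b} a≢b with toℕ a ℕ.<? toℕ b
... | yes a<b = a<b
... | no  a≮b = ℕₚ.≤∧≢⇒< (ℕₚ.≮⇒≥ a≮b) (a≢b ∘ sym ∘ Finₚ.toℕ-injective)

sort-unique : ∀ {n} {x : Fin n × Fin n} {a b} → Ordered x → Joins x a b → x ≡ sort a b
sort-unique {a = a} {b} a<b (inj₁ refl) with toℕ a ℕ.<? toℕ b
... | yes _   = refl
... | no  a≮b = contradiction a<b a≮b
sort-unique {a = a} {b} b<a (inj₂ refl) with toℕ a ℕ.<? toℕ b
... | yes a<b = contradiction a<b (ℕₚ.<⇒≯ b<a)
... | no  _   = refl

module Relabel {n : ℕ} (σ : Permutation′ n) where

  private
    image : Fin (L n) → Fin n × Fin n
    image p = sort (σ ⟨$⟩ʳ proj₁ (edgeAt {n} p)) (σ ⟨$⟩ʳ proj₂ (edgeAt {n} p))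

    image-ordered : ∀ p → Ordered (image p)
    image-ordered p = sort-ordered (ℕₚ.<⇒≢ (edgeAt-ordered p) ∘ cong toℕ ∘ Injection.injective (↔⇒↣ σ))

  relabel : Fin (L n) → Fin (L n)
  relabel p = positionOf (proj₁ (image p)) (proj₂ (image p)) (image-ordered p)

  relabel-joins : ∀ p {a b} → Joins (edgeAt {n} p) a b → Joins (edgeAt {n} (relabel p)) (σ ⟨$⟩ʳ a) (σ ⟨$⟩ʳ b)
  relabel-joins p j rewrite edgeAt-positionOf _ _ (image-ordered p) with j
  ... | inj₁ refl = sort-joins _ _
  ... | inj₂ refl = Joins-swap (sort-joins _ _)

joins-unique : ∀ {n} {p q : Fin (L n)} {a b} → Joins (edgeAt {n} p) a b → Joins (edgeAt {n} q) a b → p ≡ q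
joins-unique {p = p} {q} jp jq =
  edgeAt-injective p q (trans (sort-unique (edgeAt-ordered p) jp) (sym (sort-unique (edgeAt-ordered q) jq)))

open Relabel using (relabel; relabel-joins)

relabel-inverse : ∀ {n} (σ : Permutation′ n) p → relabel (Perm.flip σ) (relabel σ p) ≡ p
relabel-inverse σ p = joins-unique
  (subst₂ (Joins _) (inverseˡ σ) (inverseˡ σ) (relabel-joins (Perm.flip σ) (relabel σ p) (relabel-joins σ p (inj₁ refl))))
  (inj₁ refl)

relabelₚ : ∀ {n} → Permutation′ n → Permutation′ (L n)
relabelₚ σ = Perm.permutation (relabel σ) (relabel (Perm.flip σ)) (relabel-inverse (Perm.flip σ)) (relabel-inverse σ)

bool-ext : ∀ {a b : Bool} → (a ≡ true → b ≡ true) → (b ≡ true → a ≡ true) → a ≡ b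
bool-ext {true}  {true}  _ _ = refl
bool-ext {true}  {false} f _ = sym (f refl)
bool-ext {false} {true}  _ g = g refl
bool-ext {false} {false} _ _ = refl

≅⇒relabel : ∀ {n} {G H : Graph n} ((σ , _) : G ≅ H) → ∀ p → lookup (edges G) p ≡ lookup (edges H) (relabel σ p)
≅⇒relabel {n} {G} {H} (σ , G≅H) p = bool-ext forth back
  where
  u = proj₁ (edgeAt {n} p)
  v = proj₂ (edgeAt {n} p)
  forth : lookup (edges G) p ≡ true → lookup (edges H) (relabel σ p) ≡ true
  forth Gp with proj₁ (G≅H u v) (p , Vecₚ.lookup⇒[]= p (edges G) Gp , inj₁ refl)
  ... | q , q∈H , q-joins = subst (λ r → lookup (edges H) r ≡ true)
                                  (joins-unique q-joins (relabel-joins σ p (inj₁ refl))) (Vecₚ.[]=⇒lookup q∈H)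
  back : lookup (edges H) (relabel σ p) ≡ true → lookup (edges G) p ≡ true
  back Hσp with proj₂ (G≅H u v) (relabel σ p , Vecₚ.lookup⇒[]= _ (edges H) Hσp , relabel-joins σ p (inj₁ refl))
  ... | q , q∈G , q-joins = subst (λ r → lookup (edges G) r ≡ true) (joins-unique q-joins (inj₁ refl)) (Vecₚ.[]=⇒lookup q∈G)

relabel⇒≅ : ∀ {n} (σ : Permutation′ n) (Z Z′ : Subset (L n)) →
  (∀ p → lookup Z p ≡ lookup Z′ (relabel σ p)) → mkGraph Z ≅ mkGraph Z′
relabel⇒≅ {n} σ Z Z′ Z~Z′ = σ , λ i j → forth , back
  where
  forth : ∀ {i j} → Adj (mkGraph Z) i j → Adj (mkGraph Z′) (σ ⟨$⟩ʳ i) (σ ⟨$⟩ʳ j)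
  forth (q , q∈Z , q-joins) = relabel σ q , Vecₚ.lookup⇒[]= _ Z′ (trans (sym (Z~Z′ q)) (Vecₚ.[]=⇒lookup q∈Z)) , relabel-joins σ q q-joins
  back : ∀ {i j} → Adj (mkGraph Z′) (σ ⟨$⟩ʳ i) (σ ⟨$⟩ʳ j) → Adj (mkGraph Z) i j
  back (q , q∈Z′ , q-joins) =
    relabel (Perm.flip σ) q ,
    Vecₚ.lookup⇒[]= _ Z (trans (Z~Z′ _) (trans (cong (lookup Z′) (relabel-inverse (Perm.flip σ) q)) (Vecₚ.[]=⇒lookup q∈Z′))) ,
    subst₂ (Joins _) (inverseˡ σ) (inverseˡ σ) (relabel-joins (Perm.flip σ) q q-joins)

≅-refl : ∀ {n} (G : Graph n) → G ≅ G
≅-refl G = Perm.id , λ i j → (λ a → a) , (λ a → a)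

≅-sym : ∀ {n} {G H : Graph n} → G ≅ H → H ≅ G
≅-sym {n} {G} {H} (σ , G≅H) = Perm.flip σ , λ i j →
  (λ a → proj₂ (G≅H (σ ⟨$⟩ˡ i) (σ ⟨$⟩ˡ j)) (subst₂ (Adj H) (sym (inverseʳ σ)) (sym (inverseʳ σ)) a)) ,
  (λ a → subst₂ (Adj H) (inverseʳ σ) (inverseʳ σ) (proj₁ (G≅H (σ ⟨$⟩ˡ i) (σ ⟨$⟩ˡ j)) a))

≅-trans : ∀ {n} {G H K : Graph n} → G ≅ H → H ≅ K → G ≅ K
≅-trans (σ , G≅H) (ρ , H≅K) = σ Perm.∘ₚ ρ , λ i j →
  (λ a → proj₁ (H≅K _ _) (proj₁ (G≅H i j) a)) , (λ a → proj₂ (G≅H i j) (proj₂ (H≅K _ _) a))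

∑ᴸ : ∀ {a} {A : Set a} → List A → (A → ℤ) → ℤ
∑ᴸ xs f = List.foldr _+_ 0ℤ (List.map f xs)

∑ᴸ-++ : ∀ {a} {A : Set a} (xs ys : List A) f → ∑ᴸ (xs ++ ys) f ≡ ∑ᴸ xs f + ∑ᴸ ys f
∑ᴸ-++ []       ys f = sym (ℤₚ.+-identityˡ _)
∑ᴸ-++ (x ∷ xs) ys f = trans (cong (_+_ (f x)) (∑ᴸ-++ xs ys f)) (sym (ℤₚ.+-assoc (f x) _ _))

∑ᴸ-map : ∀ {a b} {A : Set a} {B : Set b} (g : A → B) (xs : List A) f → ∑ᴸ (List.map g xs) f ≡ ∑ᴸ xs (f ∘ g)
∑ᴸ-map g []       f = refl
∑ᴸ-map g (x ∷ xs) f = cong (_+_ (f (g x))) (∑ᴸ-map g xs f)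

∑ᴸ-tabulate : ∀ {a} {A : Set a} {n} (g : Fin n → A) f → ∑ᴸ (tabulate g) f ≡ ∑ (f ∘ g)
∑ᴸ-tabulate {n = zero}  g f = sym (∑-[] _)
∑ᴸ-tabulate {n = suc n} g f = trans (cong (_+_ (f (g zero))) (∑ᴸ-tabulate (g ∘ suc) f)) (sym (∑-suc _))

∑ᴸ-allFin : ∀ n (f : Fin n → ℤ) → ∑ᴸ (allFin n) f ≡ ∑ f
∑ᴸ-allFin n f = ∑ᴸ-tabulate (λ x → x) f

∑ᴸ-allSubsets : ∀ k (f : Subset k → ℤ) → ∑ᴸ (allSubsets k) f ≡ ∑ˢ k f
∑ᴸ-allSubsets zero    f = ℤₚ.+-identityʳ _
∑ᴸ-allSubsets (suc k) f = trans (∑ᴸ-++ (List.map (true ∷_) (allSubsets k)) _ f)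
  (cong₂ _+_ (trans (∑ᴸ-map (true ∷_) (allSubsets k) f) (∑ᴸ-allSubsets k _))
             (trans (∑ᴸ-map (false ∷_) (allSubsets k) f) (∑ᴸ-allSubsets k _)))

∑ᴸ-cartesianProduct : ∀ {a b} {A : Set a} {B : Set b} (xs : List A) (ys : List B) f →
  ∑ᴸ (cartesianProduct xs ys) f ≡ ∑ᴸ xs (λ x → ∑ᴸ ys (λ y → f (x , y)))
∑ᴸ-cartesianProduct []       ys f = refl
∑ᴸ-cartesianProduct (x ∷ xs) ys f = trans (∑ᴸ-++ (List.map (x ,_) ys) _ f)
  (cong₂ _+_ (∑ᴸ-map (x ,_) ys f) (∑ᴸ-cartesianProduct xs ys f))

length-filter : ∀ {a p} {A : Set a} {P : Pred A p} (P? : Decidable P) xs →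
  + length (filter P? xs) ≡ ∑ᴸ xs (λ x → when (does (P? x)) 1ℤ)
length-filter P? []       = refl
length-filter P? (x ∷ xs) with does (P? x)
... | true  = cong (_+_ 1ℤ) (length-filter P? xs)
... | false = trans (length-filter P? xs) (sym (ℤₚ.+-identityˡ _))

length-concatMap : ∀ {a b} {A : Set a} {B : Set b} (g : A → List B) xs →
  + length (concatMap g xs) ≡ ∑ᴸ xs (λ x → + length (g x))
length-concatMap g []       = refl
length-concatMap g (x ∷ xs) = trans (cong +_ (Listₚ.length-++ (g x)))
  (trans (ℤₚ.pos-+ (length (g x)) _) (cong (_+_ (+ length (g x))) (length-concatMap g xs)))

∑-1 : ∀ n → ∑ {n} (λ _ → 1ℤ) ≡ + n
∑-1 zero    = ∑-[] _
∑-1 (suc n) = trans (∑-suc _) (cong (_+_ 1ℤ) (∑-1 n))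

below : ∀ {n} → Fin n → Fin n → ℤ
below j i = when (does (toℕ i ℕ.<? toℕ j)) 1ℤ

L≡∑below : ∀ n → + L n ≡ ∑ {n} (λ j → ∑ (below j))
L≡∑below n = trans (length-concatMap _ (allFin n)) (trans (∑ᴸ-allFin n _) (∑-cong column))
  where
  column : ∀ j → + length (List.map (_, j) (filter (λ i → toℕ i ℕ.<? toℕ j) (allFin n))) ≡ ∑ (below j)
  column j = trans (cong +_ (Listₚ.length-map _ (filter (λ i → toℕ i ℕ.<? toℕ j) (allFin n))))
                   (trans (length-filter (λ i → toℕ i ℕ.<? toℕ j) (allFin n)) (∑ᴸ-allFin n _))

∑below-suc : ∀ n → ∑ {suc n} (λ j → ∑ (below j)) ≡ + n + ∑ {n} (λ j → ∑ (below j))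
∑below-suc n = begin
  ∑ {suc n} (λ j → ∑ (below j))
    ≡⟨ ∑-suc _ ⟩
  ∑ {suc n} (below zero) + ∑ {n} (λ j → ∑ (below (suc j)))
    ≡⟨ cong₂ _+_ (trans (∑-suc _) (trans (ℤₚ.+-identityˡ _) (∑-0 n))) (∑-cong (λ j → ∑-suc (below (suc j)))) ⟩
  0ℤ + ∑ {n} (λ j → 1ℤ + ∑ (below j))
    ≡⟨ ℤₚ.+-identityˡ _ ⟩
  ∑ {n} (λ j → 1ℤ + ∑ (below j))
    ≡⟨ ∑-+ (λ _ → 1ℤ) _ ⟩
  ∑ {n} (λ _ → 1ℤ) + ∑ (λ j → ∑ (below j))
    ≡⟨ cong (_+ ∑ {n} (λ j → ∑ (below j))) (∑-1 n) ⟩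
  + n + ∑ {n} (λ j → ∑ (below j)) ∎
  where open ≡-Reasoning

∑below≡C2 : ∀ n → ∑ {n} (λ j → ∑ (below j)) ≡ + (n C 2)
∑below≡C2 zero    = ∑-[] _
∑below≡C2 (suc n) = begin
  ∑ {suc n} (λ j → ∑ (below j))   ≡⟨ ∑below-suc n ⟩
  + n + ∑ {n} (λ j → ∑ (below j)) ≡⟨ cong (_+_ (+ n)) (∑below≡C2 n) ⟩
  + n + + (n C 2)                 ≡⟨ cong (λ x → + x + + (n C 2)) (nC1≡n n) ⟨
  + (n C 1 ℕ.+ n C 2)             ≡⟨ cong +_ (nCk+nC[k+1]≡[n+1]C[k+1] n 1) ⟩
  + (suc n C 2)                   ∎
  where open ≡-Reasoning

L≡C2 : ∀ n → + L n ≡ + (n C 2)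
L≡C2 n = trans (L≡∑below n) (∑below≡C2 n)

≅-indicator : ∀ {n} → IsoDec n → Graph n → Subset (L n) → ℤ
≅-indicator iso? G Z = when (does (iso? (mkGraph Z) G)) 1ℤ

when-∧-assoc : ∀ a b c x → when (a ∧ (b ∧ c)) x ≡ when (a ∧ b) (when c x)
when-∧-assoc a b c x = trans (cong (λ d → when d x) (sym (Boolₚ.∧-assoc a b c))) (sym (when-∧ (a ∧ b) c x))

Δcount≡switches : ∀ {n} (iso? : IsoDec n) j (G H : Graph n) →
  + Δcount iso? j G H ≡ switches j (≅-indicator iso? G) (edges H)
Δcount≡switches {n} iso? j G H = begin
  + Δcount iso? j G H
    ≡⟨ length-filter (switch? iso? j G H) (cartesianProduct S S) ⟩
  ∑ᴸ (cartesianProduct S S) (λ x → when (does (switch? iso? j G H x)) 1ℤ)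
    ≡⟨ ∑ᴸ-cartesianProduct S S _ ⟩
  ∑ᴸ S (λ A → ∑ᴸ S (λ B → when (does (switch? iso? j G H (A , B))) 1ℤ))
    ≡⟨ ∑ᴸ-allSubsets (L n) _ ⟩
  ∑ˢ (L n) (λ A → ∑ᴸ S (λ B → when (does (switch? iso? j G H (A , B))) 1ℤ))
    ≡⟨ ∑ˢ-cong (L n) (λ A → trans (∑ᴸ-allSubsets (L n) _) (switches-from A)) ⟩
  switches j (≅-indicator iso? G) (edges H) ∎
  where
  open ≡-Reasoning
  S = allSubsets (L n)
  E = edges H
  switches-from : ∀ A → ∑ˢ (L n) (λ B → when (does (switch? iso? j G H (A , B))) 1ℤ)
                      ≡ when (A ⊆ᵇ E ∧ (∣ A ∣ ℕ.≡ᵇ j)) (additions j (≅-indicator iso? G) (E ─ A))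
  switches-from A = trans
    (∑ˢ-cong (L n) (λ B → trans (when-∧-assoc (A ⊆ᵇ E) (∣ A ∣ ℕ.≡ᵇ j) _ _)
                                (cong (when (A ⊆ᵇ E ∧ (∣ A ∣ ℕ.≡ᵇ j))) (when-∧-assoc (B ⊆ᵇ ∁ (E ─ A)) (∣ B ∣ ℕ.≡ᵇ j) _ _))))
    (∑ˢ-when (L n) (A ⊆ᵇ E ∧ (∣ A ∣ ℕ.≡ᵇ j)) _)

iso?-respects-≅ : ∀ {n} (iso? : IsoDec n) {X X′ : Graph n} (G : Graph n) → X ≅ X′ → does (iso? X G) ≡ does (iso? X′ G)
iso?-respects-≅ iso? {X} {X′} G X≅X′ with iso? X′ G
... | yes X′≅G = dec-true (iso? X G) (≅-trans X≅X′ X′≅G)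
... | no  X′≇G = dec-false (iso? X G) (X′≇G ∘ ≅-trans (≅-sym X≅X′))

≅-indicator-invariant : ∀ {n} (iso? : IsoDec n) (G : Graph n) (σ : Permutation′ n) →
  Invariant (relabelₚ σ) (≅-indicator iso? G)
≅-indicator-invariant iso? G σ Z Z′ Z~Z′ = cong (λ b → when b 1ℤ) (iso?-respects-≅ iso? G (relabel⇒≅ σ Z Z′ Z~Z′))

∑-*+-distrib : ∀ {r} c (x y z : Fin r → ℤ) → ∑ (λ p → (c ℤ.* x p + y p) ℤ.* z p) ≡ c ℤ.* ∑ (λ p → x p ℤ.* z p) + ∑ (λ p → y p ℤ.* z p)
∑-*+-distrib c x y z = trans (∑-cong (λ p → expand c (x p) (y p) (z p)))
                             (trans (∑-+ _ _) (cong (_+ _) (∑-* c (λ p → x p ℤ.* z p))))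
  where
  expand : ∀ c x y z → (c ℤ.* x + y) ℤ.* z ≡ c ℤ.* (x ℤ.* z) + y ℤ.* z
  expand = solve-∀

does-≟-comm : ∀ {r} (a b : Fin r) → does (a Fin.≟ b) ≡ does (b Fin.≟ a)
does-≟-comm a b with b Fin.≟ a
... | yes refl = dec-true (a Fin.≟ a) refl
... | no  b≢a  = dec-false (a Fin.≟ b) (b≢a ∘ sym)

module Matrices {n m : ℕ} (iso? : IsoDec n) (reps : List (Graph n)) (reps-ok : IsReps n m reps) where

  open IsReps reps-ok using (covers; distinct)

  private
    G : Fin (length reps) → Graph n
    G = List.lookup reps

  E : Fin (length reps) → Subset (L n)
  E p = edges (G p)

  𝟙 : Fin (length reps) → Subset (L n) → ℤ
  𝟙 p = ≅-indicator iso? (G p)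

  Δ≡switches : ∀ j a b → Δ iso? reps j a b ≡ switches j (𝟙 a) (E b)
  Δ≡switches j a b = Δcount≡switches iso? j (G a) (G b)

  iso?-reps : ∀ {X} p₀ → X ≅ G p₀ → ∀ p → does (iso? X (G p)) ≡ does (p Fin.≟ p₀)
  iso?-reps {X} p₀ X≅p₀ p with p Fin.≟ p₀
  ... | yes refl = dec-true (iso? X (G p)) X≅p₀
  ... | no  p≢p₀ = dec-false (iso? X (G p)) (λ X≅p → p≢p₀ (distinct p p₀ (≅-trans (≅-sym X≅p) X≅p₀)))

  Δ₀-identityˡ : ∀ a (M : Fin (length reps) → ℤ) → ∑ (λ p → Δ iso? reps 0 a p ℤ.* M p) ≡ M a
  Δ₀-identityˡ a M = trans (∑-cong δ) (∑-δ a M)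
    where
    δ : ∀ p → Δ iso? reps 0 a p ℤ.* M p ≡ when (does (p Fin.≟ a)) (M p)
    δ p = begin
      Δ iso? reps 0 a p ℤ.* M p                 ≡⟨ cong (ℤ._* M p) (trans (Δ≡switches 0 a p) (switches-zero (𝟙 a) (E p))) ⟩
      when (does (iso? (G p) (G a))) 1ℤ ℤ.* M p  ≡⟨ cong (λ b → when b 1ℤ ℤ.* M p) (trans (iso?-reps p (≅-refl (G p)) a) (does-≟-comm a p)) ⟩
      when (does (p Fin.≟ a)) 1ℤ ℤ.* M p         ≡⟨ when≡when1* (does (p Fin.≟ a)) (M p) ⟨
      when (does (p Fin.≟ a)) (M p)              ∎
      where open ≡-Reasoning

  ∑-switches-one : ∀ a Z → ∣ Z ∣ ≡ m → ∑ (λ p → switches 1 (𝟙 a) (E p) ℤ.* 𝟙 p Z) ≡ down (up (𝟙 a)) Z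
  ∑-switches-one a Z ∣Z∣≡m = begin
    ∑ (λ p → switches 1 (𝟙 a) (E p) ℤ.* 𝟙 p Z)     ≡⟨ ∑-cong select ⟩
    ∑ (λ p → when (does (p Fin.≟ p₀)) (S p))       ≡⟨ ∑-δ p₀ S ⟩
    switches 1 (𝟙 a) (E p₀)                        ≡⟨ switches-one (𝟙 a) (E p₀) ⟩
    down (up (𝟙 a)) (E p₀)                         ≡⟨ down-invariant π (up (𝟙 a)) (up-invariant π (𝟙 a) (≅-indicator-invariant iso? (G a) σ))
                                                                     Z (E p₀) (≅⇒relabel Z≅p₀) ⟨
    down (up (𝟙 a)) Z                              ∎
    where
    open ≡-Reasoning
    S : Fin (length reps) → ℤ
    S p = switches 1 (𝟙 a) (E p)
    covered : Any (mkGraph Z ≅_) reps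
    covered = covers (mkGraph Z) ∣Z∣≡m
    p₀ = Any.index covered
    Z≅p₀ : mkGraph Z ≅ G p₀
    Z≅p₀ = lookup-index covered
    σ = proj₁ Z≅p₀
    π = relabelₚ σ
    select : ∀ p → S p ℤ.* 𝟙 p Z ≡ when (does (p Fin.≟ p₀)) (S p)
    select p = trans (ℤₚ.*-comm (S p) _) (trans (cong (λ b → when b 1ℤ ℤ.* S p) (iso?-reps p₀ Z≅p₀ p))
                                                (sym (when≡when1* _ (S p))))

  Δ₁·Δ-switches : ∀ i a b → ∑ (λ p → Δ iso? reps 1 a p ℤ.* Δ iso? reps i p b) ≡ switches i (down (up (𝟙 a))) (E b)
  Δ₁·Δ-switches i a b = begin
    ∑ (λ p → Δ iso? reps 1 a p ℤ.* Δ iso? reps i p b)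
      ≡⟨ ∑-cong (λ p → cong₂ ℤ._*_ (Δ≡switches 1 a p) (Δ≡switches i p b)) ⟩
    ∑ (λ p → switches 1 (𝟙 a) (E p) ℤ.* switches i (𝟙 p) (E b))
      ≡⟨ ∑-cong (λ p → switches-* i (switches 1 (𝟙 a) (E p)) (𝟙 p) (E b)) ⟨
    ∑ (λ p → switches i (λ Z → switches 1 (𝟙 a) (E p) ℤ.* 𝟙 p Z) (E b))
      ≡⟨ switches-∑ i (λ p Z → switches 1 (𝟙 a) (E p) ℤ.* 𝟙 p Z) (E b) ⟨
    switches i (λ Z → ∑ (λ p → switches 1 (𝟙 a) (E p) ℤ.* 𝟙 p Z)) (E b)
      ≡⟨ switches-cong-level i (E b) (λ Z ∣Z∣≡∣E∣ → ∑-switches-one a Z (trans ∣Z∣≡∣E∣ (IsReps.edges reps-ok b))) ⟩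
    switches i (down (up (𝟙 a))) (E b) ∎
    where open ≡-Reasoning

  Δ₁·Δ : ∀ i a b → ∑ (λ p → Δ iso? reps 1 a p ℤ.* Δ iso? reps i p b)
    ≡ (+ suc i ℤ.* + suc i) ℤ.* Δ iso? reps (suc i) a b + (+ i ℤ.* (+ (n C 2) - + m - + m + + i + 1ℤ)) ℤ.* Δ iso? reps i a b
  Δ₁·Δ i a b = begin
    ∑ (λ p → Δ iso? reps 1 a p ℤ.* Δ iso? reps i p b)
      ≡⟨ Δ₁·Δ-switches i a b ⟩
    switches i (down (up (𝟙 a))) (E b)
      ≡⟨ switches-down-up i (𝟙 a) (E b) ⟩
    s ℤ.* switches (suc i) (𝟙 a) (E b) + κ (+ L n) ∣ E b ∣ ℤ.* switches i (𝟙 a) (E b)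
      ≡⟨ cong₂ (λ N e → s ℤ.* switches (suc i) (𝟙 a) (E b) + κ N e ℤ.* switches i (𝟙 a) (E b))
               (L≡C2 n) (IsReps.edges reps-ok b) ⟩
    s ℤ.* switches (suc i) (𝟙 a) (E b) + κ (+ (n C 2)) m ℤ.* switches i (𝟙 a) (E b)
      ≡⟨ cong₂ (λ x y → s ℤ.* x + κ (+ (n C 2)) m ℤ.* y) (Δ≡switches (suc i) a b) (Δ≡switches i a b) ⟨
    s ℤ.* Δ iso? reps (suc i) a b + κ (+ (n C 2)) m ℤ.* Δ iso? reps i a b ∎
    where
    open ≡-Reasoning
    s = + suc i ℤ.* + suc i
    κ : ℤ → ℕ → ℤ
    κ N e = + i ℤ.* (N - + e - + e + + i + 1ℤ)

lemma2p3 : (n : ℕ) → 1 ≤ n → (m : ℕ) → m ≤ n C 2 →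
    (iso? : IsoDec n) → (reps : List (Graph n)) → IsReps n m reps →
    (i : ℕ) → (k l : Fin (length reps)) →
    (+ (suc i * suc i)) ℤ.* Δ iso? reps (suc i) k l
      ≡ ((λ a b → ((+ i) ℤ.* ((+ (2 * m)) ℤ.- (+ (n C 2)) ℤ.- (+ i) ℤ.- (+ 1))) ℤ.* Δ iso? reps 0 a b ℤ.+ Δ iso? reps 1 a b)
          · Δ iso? reps i) k l
lemma2p3 n _ m _ iso? reps reps-ok i k l = sym (begin
  ∑ᴸ (allFin r) (λ p → (c ℤ.* Δ₀ k p + Δ₁ k p) ℤ.* Δᵢ p l)
    ≡⟨ ∑ᴸ-allFin r _ ⟩
  ∑ (λ p → (c ℤ.* Δ₀ k p + Δ₁ k p) ℤ.* Δᵢ p l)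
    ≡⟨ ∑-*+-distrib c (Δ₀ k) (Δ₁ k) (λ p → Δᵢ p l) ⟩
  c ℤ.* ∑ (λ p → Δ₀ k p ℤ.* Δᵢ p l) + ∑ (λ p → Δ₁ k p ℤ.* Δᵢ p l)
    ≡⟨ cong₂ (λ x y → c ℤ.* x + y) (Δ₀-identityˡ k (λ p → Δᵢ p l)) (Δ₁·Δ i k l) ⟩
  c ℤ.* Δᵢ k l + rhs
    ≡⟨ cong (λ z → + i ℤ.* (z - + (n C 2) - + i - + 1) ℤ.* Δᵢ k l + rhs) (ℤₚ.pos-* 2 m) ⟩
  + i ℤ.* (+ 2 ℤ.* + m - + (n C 2) - + i - + 1) ℤ.* Δᵢ k l + rhs
    ≡⟨ cancel (+ i) (+ m) (+ (n C 2)) (Δᵢ k l) (Δₛ k l) ⟩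
  (+ suc i ℤ.* + suc i) ℤ.* Δₛ k l
    ≡⟨ cong (ℤ._* Δₛ k l) (ℤₚ.pos-* (suc i) (suc i)) ⟨
  + (suc i * suc i) ℤ.* Δₛ k l ∎)
  where
  open ≡-Reasoning
  open Matrices iso? reps reps-ok
  r = length reps
  Δ₀ = Δ iso? reps 0
  Δ₁ = Δ iso? reps 1
  Δᵢ = Δ iso? reps i
  Δₛ = Δ iso? reps (suc i)
  c = + i ℤ.* (+ (2 * m) - + (n C 2) - + i - + 1)
  rhs = (+ suc i ℤ.* + suc i) ℤ.* Δₛ k l + (+ i ℤ.* (+ (n C 2) - + m - + m + + i + 1ℤ)) ℤ.* Δᵢ k l
  cancel : ∀ i m N x y → i ℤ.* ((1ℤ + 1ℤ) ℤ.* m - N - i - 1ℤ) ℤ.* x + ((1ℤ + i) ℤ.* (1ℤ + i) ℤ.* y + i ℤ.* (N - m - m + i + 1ℤ) ℤ.* x)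
                       ≡ (1ℤ + i) ℤ.* (1ℤ + i) ℤ.* y
  cancel = solve-∀
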